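{- Let $\mathcal{G}=(\mathcal{X},\Sigma,\mathcal{P},S_0)$ be a proper thin GVAS, and let $\iota(\mathcal{G})$ be its index as defined recursively below. Then $$\iota(\mathcal{G})=\sup\{k_{\mathcal{T}} \mid \mathcal{T}\text{ a complete derivation tree of }\mathcal{G}\text{ with root }S_0\},$$ where $k_{\mathcal{T}}$ is the minimum, over all derivation sequences $S_0=\alpha_0\to\alpha_1\to\dots\to\alpha_n$ realizing $\mathcal{T}$, of $\max_i$ (number of nonterminal occurrences in $\alpha_i$).
   Context: A GVAS is a context-free grammar in Chomsky normal form with integer-vector terminals, rules $X\to AB$ or $X\to\mathbf{u}$, start symbol $S_0$; proper means every symbol is derivable from $S_0$ and every nonterminal derives a word of terminals. The production graph has edges $X\to A$, $X\to B$ for each rule $X\to AB$ and $X\to\mathbf{u}$ for each rule $X\to\mathbf{u}$. The GVAS is thin if no rule $X\to AB$ has $X,A,B$ in a common strongly connected component (SCC). For a rule $X\to AB$: it is left-degenerate if $B$ but not $A$ is in the SCC of $X$, right-degenerate if $A$ but not $B$ is, and fully degenerate if neither is. For a nonterminal $A$, $\mathcal{G}_A$ denotes the proper sub-GVAS with start symbol $A$ consisting of all rules reachable from $A$. A derivation sequence realizes a derivation tree $\mathcal{T}$ if it applies exactly the rules at the internal nodes of $\mathcal{T}$, one per step, in some order compatible with the tree. Recursive index: let $\mathcal{X}_{\mathrm{top}}$ be the set of nonterminals in the topmost SCC (the SCC of $S_0$) of the production graph. $\iota(\mathcal{G})$ is the smallest positive integer $k$ such that for every $X\in\mathcal{X}_{\mathrm{top}}$: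 for every left-degenerate rule $X\to AY$ or right-degenerate rule $X\to YA$ (with $Y$ in the SCC of $X$), $k\geq\iota(\mathcal{G}_A)+1$; and for every fully degenerate rule $X\to AB$, $k\geq\max\{\iota(\mathcal{G}_A),\iota(\mathcal{G}_B)\}$ if $\iota(\mathcal{G}_A)\neq\iota(\mathcal{G}_B)$, and $k\geq\iota(\mathcal{G}_A)+1$ if $\iota(\mathcal{G}_A)=\iota(\mathcal{G}_B)$. (A trivial GVAS, e.g. one whose only rules are $S_0\to\mathbf{u}$, has index $1$.) -}

module Defs where

open import Data.Nat using (ℕ; zero; suc; _+_; _≤_; _⊔_)
open import Data.Integer using (ℤ)
open import Data.Fin using (Fin)
open import Data.Vec using (Vec)
open import Data.List using (List; []; _∷_; _++_)
open import Data.List.Membership.Propositional using (_∈_)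
open import Data.List.Relation.Unary.All using (All)
open import Data.Product using (Σ; _×_; ∃)
open import Data.Sum using (_⊎_)
open import Data.Unit using (⊤)
open import Data.Empty using (⊥)
open import Relation.Nullary using (¬_)
open import Relation.Binary.PropositionalEquality using (_≡_; _≢_)
open import Relation.Binary.Construct.Closure.ReflexiveTransitive using (Star)

IsLeast : (ℕ → Set) → ℕ → Set
IsLeast P v = P v × (∀ k → P k → v ≤ k)

IsLUB : (ℕ → Set) → ℕ → Set
IsLUB P v = (∀ k → P k → k ≤ v) × (∀ b → (∀ k → P k → k ≤ b) → v ≤ b)

-- GVAS in Chomsky normal form: nonterminals Fin n, terminals in ℤ^d

data Rule (d n : ℕ) : Set where
  bin  : (X A B : Fin n) → Rule d n
  term : (X : Fin n) → Vec ℤ d → Rule d n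

record GVAS (d n : ℕ) : Set where
  field
    rules : List (Rule d n)
    start : Fin n

open GVAS public

module _ {d n : ℕ} (G : GVAS d n) where

  -- Production graph, restricted to nonterminal vertices
  -- (terminal vertices are sinks and do not affect SCCs of nonterminals)
  Edge : Fin n → Fin n → Set
  Edge X Y = ∃ λ A → ∃ λ B → (bin X A B ∈ rules G) × ((Y ≡ A) ⊎ (Y ≡ B))

  Reach : Fin n → Fin n → Set
  Reach = Star Edge

  SameSCC : Fin n → Fin n → Set
  SameSCC X Y = Reach X Y × Reach Y X

  data Tree : Fin n → Set where
    node : ∀ {X A B} → bin X A B ∈ rules G → Tree A → Tree B → Tree X
    leaf : ∀ {X} (u : Vec ℤ d) → term X u ∈ rules G → Tree X

  Proper : Set
  Proper = (∀ X → Reach (start G) X) × (∀ X → Tree X)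

  Thin : Set
  Thin = ∀ X A B → bin X A B ∈ rules G → ¬ (SameSCC X A × SameSCC X B)

  -- Recursive index.  ι X stands for ι(𝒢_X), the index of the sub-GVAS
  -- with start symbol X (its topmost SCC is the SCC of X).

  IndexOK : (Fin n → ℕ) → Fin n → ℕ → Set
  IndexOK ι X k =
    (1 ≤ k) ×
    (∀ Y A B → SameSCC X Y → bin Y A B ∈ rules G →
      ((¬ SameSCC Y A × SameSCC Y B) → ι A + 1 ≤ k) ×
      ((SameSCC Y A × ¬ SameSCC Y B) → ι B + 1 ≤ k) ×
      ((¬ SameSCC Y A × ¬ SameSCC Y B) →
         (ι A ≢ ι B → ι A ⊔ ι B ≤ k) × (ι A ≡ ι B → ι A + 1 ≤ k)))

  IsIndexFn : (Fin n → ℕ) → Set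
  IsIndexFn ι = ∀ X → IsLeast (IndexOK ι X) (ι X)

  -- A sentential form is a list of
  -- items: a terminal, or a nonterminal occurrence A tagged with the
  -- subtree of 𝒯 that is still to be expanded at that occurrence.

  data Item : Set where
    tm   : Vec ℤ d → Item
    pend : ∀ {X} → Tree X → Item

  nonterms : List Item → ℕ
  nonterms []            = 0
  nonterms (tm _ ∷ s)    = nonterms s
  nonterms (pend _ ∷ s)  = suc (nonterms s)

  IsTm : Item → Set
  IsTm (tm _)   = ⊤
  IsTm (pend _) = ⊥

  data Step : List Item → List Item → Set where
    expand : ∀ pre post {X A B} (r : bin X A B ∈ rules G) (tA : Tree A) (tB : Tree B) →
             Step (pre ++ pend (node r tA tB) ∷ post) (pre ++ pend tA ∷ pend tB ∷ post)
    finish : ∀ pre post {X} (u : Vec ℤ d) (r : term X u ∈ rules G) →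
             Step (pre ++ pend (leaf u r) ∷ post) (pre ++ tm u ∷ post)

  data Run : List Item → ℕ → Set where
    stop : ∀ s → All IsTm s → Run s (nonterms s)
    go   : ∀ {s s' m} → Step s s' → Run s' m → Run s (nonterms s ⊔ m)

  IsKT : ∀ {X} → Tree X → ℕ → Set
  IsKT T = IsLeast (Run (pend T ∷ []))

-- The index ι(𝒢_X) is the largest Strahler number of a complete derivation tree rooted at X,
-- and k_𝒯 is the Strahler number of 𝒯 (a leaf has Strahler number 1, a node with children of
-- Strahler numbers a and b has a ⊔⁺ b, i.e. max a b if a ≢ b and a + 1 if a ≡ b).  A derivation
-- sequence that always expands the child with larger Strahler number first attains it, and no
-- sequence does better: if some pending subtree has Strahler number ≥ u + 1, the maximum number of
-- nonterminals still to come is at least u plus the number of such subtrees.  In a thin grammar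
-- Strahler numbers are bounded by the number of nonterminals, so repeatedly improving a chosen tree
-- for every nonterminal by one rule application stabilises at trees of maximal Strahler number.
-- These maxima satisfy the recursive constraints of the index, and any two solutions agree, since
-- the constraints on an SCC only refer to values on strictly lower SCCs.
module Submission where

open import Defs
open import Data.Nat
open import Data.Nat.Properties
open import Data.Fin using (Fin; zero; suc)
import Data.Fin as Fin
open import Data.Fin.Properties using (all?; ¬∀⟶∃¬)
open import Data.Fin.Induction using (spo-wellFounded)
open import Data.Fin.Subset using (Subset; ⁅_⁆; _∪_; ∣_∣; _⊆_) renaming (_∈_ to _∈ₛ_)
open import Data.Fin.Subset.Properties
  using (x∈⁅x⁆; x∈⁅y⁆⇒x≡y; ∣⁅x⁆∣≡1; x∈p∪q⁻; p⊆p∪q; q⊆p∪q; p⊆q⇒∣p∣≤∣q∣; p⊂q⇒∣p∣<∣q∣; ∣p∣≤n)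
  renaming (_∈?_ to _∈ₛ?_)
open import Data.Product using (Σ; _×_; _,_; proj₁; proj₂; ∃)
open import Data.Sum using (_⊎_; inj₁; inj₂)
open import Data.List using (List; []; _∷_; _++_)
open import Data.List.Properties using (++-assoc)
open import Data.List.Membership.Propositional using (_∈_; mapWith∈)
open import Data.List.Relation.Unary.All using (All; []; _∷_)
import Data.List.Relation.Unary.All as All
import Data.List.Relation.Unary.All.Properties as All
open import Data.List.Relation.Unary.Any.Properties using (mapWith∈⁺)
open import Data.List.Extrema.Nat using (argmax; f[⊥]≤f[argmax]; f[xs]≤f[argmax])
open import Function using (_∘_)
open import Induction.WellFounded using (WellFounded; Acc; acc)
open import Relation.Binary.Construct.Closure.ReflexiveTransitive using (Star; ε; _◅_; _◅◅_; gmap)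
import Relation.Binary.Construct.Closure.ReflexiveTransitive as Star
open import Relation.Binary.Definitions using (tri<; tri≈; tri>)
open import Relation.Binary.PropositionalEquality
open import Relation.Nullary using (¬_; contradiction; yes; no; Dec)
open import Relation.Nullary.Decidable using (decidable-stable; ¬¬-excluded-middle)

-- Strahler arithmetic

infixl 6 _⊔⁺_

_⊔⁺_ : ℕ → ℕ → ℕ
m ⊔⁺ n = m ⊔ n ⊔ suc (m ⊓ n)

m≤m⊔⁺n : ∀ m n → m ≤ m ⊔⁺ n
m≤m⊔⁺n m n = ≤-trans (m≤m⊔n m n) (m≤m⊔n (m ⊔ n) _)

n≤m⊔⁺n : ∀ m n → n ≤ m ⊔⁺ n
n≤m⊔⁺n m n = ≤-trans (m≤n⊔m m n) (m≤m⊔n (m ⊔ n) _)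

m≤n⇒m<m⊔⁺n : ∀ {m n} → m ≤ n → m < m ⊔⁺ n
m≤n⇒m<m⊔⁺n {m} {n} m≤n = subst (_< m ⊔⁺ n) (m≤n⇒m⊓n≡m m≤n) (m≤n⊔m (m ⊔ n) _)

n≤m⇒n<m⊔⁺n : ∀ {m n} → n ≤ m → n < m ⊔⁺ n
n≤m⇒n<m⊔⁺n {m} {n} n≤m = subst (_< m ⊔⁺ n) (m≥n⇒m⊓n≡n n≤m) (m≤n⊔m (m ⊔ n) _)

⊔⁺-mono-≤ : ∀ {m m′ n n′} → m ≤ m′ → n ≤ n′ → m ⊔⁺ n ≤ m′ ⊔⁺ n′
⊔⁺-mono-≤ m≤m′ n≤n′ = ⊔-mono-≤ (⊔-mono-≤ m≤m′ n≤n′) (s≤s (⊓-mono-≤ m≤m′ n≤n′))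

⊔⁺-lub : ∀ {m n o} → m ≤ o → n ≤ o → m < o ⊎ n < o → m ⊔⁺ n ≤ o
⊔⁺-lub {m} {n} m≤o n≤o (inj₁ m<o) = ⊔-lub (⊔-lub m≤o n≤o) (≤-<-trans (m⊓n≤m m n) m<o)
⊔⁺-lub {m} {n} m≤o n≤o (inj₂ n<o) = ⊔-lub (⊔-lub m≤o n≤o) (≤-<-trans (m⊓n≤n m n) n<o)

m⊔⁺n≤n⇒m<n : ∀ {m n} → m ⊔⁺ n ≤ n → m < n
m⊔⁺n≤n⇒m<n {m} {n} h = <-≤-trans (m≤n⇒m<m⊔⁺n (≤-trans (m≤m⊔⁺n m n) h)) h

m⊔⁺n≤m⇒n<m : ∀ {m n} → m ⊔⁺ n ≤ m → n < m
m⊔⁺n≤m⇒n<m {m} {n} h = <-≤-trans (n≤m⇒n<m⊔⁺n (≤-trans (n≤m⊔⁺n m n) h)) h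

m+1≤n⇒m<n : ∀ {m n} → m + 1 ≤ n → m < n
m+1≤n⇒m<n {m} {n} = subst (_≤ n) (+-comm m 1)

m<n⇒m+1≤n : ∀ {m n} → m < n → m + 1 ≤ n
m<n⇒m+1≤n {m} {n} = subst (_≤ n) (+-comm 1 m)

⊔⁺-lub-cases : ∀ {m n o} → (m ≢ n → m ⊔ n ≤ o) × (m ≡ n → m + 1 ≤ o) → m ⊔⁺ n ≤ o
⊔⁺-lub-cases {m} {n} (m≢n⇒ , m≡n⇒) with <-cmp m n
... | tri< m<n m≢n _ = let n≤o = m⊔n≤o⇒n≤o m n (m≢n⇒ m≢n) in
  ⊔⁺-lub (<⇒≤ (<-≤-trans m<n n≤o)) n≤o (inj₁ (<-≤-trans m<n n≤o))
... | tri≈ _ refl _ = let m<o = m+1≤n⇒m<n (m≡n⇒ refl) in ⊔⁺-lub (<⇒≤ m<o) (<⇒≤ m<o) (inj₁ m<o)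
... | tri> _ m≢n n<m = let m≤o = m⊔n≤o⇒m≤o m n (m≢n⇒ m≢n) in
  ⊔⁺-lub m≤o (<⇒≤ (<-≤-trans n<m m≤o)) (inj₂ (<-≤-trans n<m m≤o))

⊔⁺-≤-cases : ∀ {m n o} → m ⊔⁺ n ≤ o → (m ≢ n → m ⊔ n ≤ o) × (m ≡ n → m + 1 ≤ o)
⊔⁺-≤-cases {m} {n} h = (λ _ → ≤-trans (m≤m⊔n (m ⊔ n) _) h)
                     , λ { refl → m<n⇒m+1≤n (<-≤-trans (m≤n⇒m<m⊔⁺n ≤-refl) h) }

⟦_≤_⟧ : ℕ → ℕ → ℕ
⟦ zero  ≤ _     ⟧ = 1
⟦ suc t ≤ zero  ⟧ = 0
⟦ suc t ≤ suc x ⟧ = ⟦ t ≤ x ⟧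

≤⇒⟦≤⟧≡1 : ∀ {t x} → t ≤ x → ⟦ t ≤ x ⟧ ≡ 1
≤⇒⟦≤⟧≡1 z≤n       = refl
≤⇒⟦≤⟧≡1 (s≤s t≤x) = ≤⇒⟦≤⟧≡1 t≤x

>⇒⟦≤⟧≡0 : ∀ {t x} → x < t → ⟦ t ≤ x ⟧ ≡ 0
>⇒⟦≤⟧≡0 {suc t} {zero}  _         = refl
>⇒⟦≤⟧≡0 {suc t} {suc x} (s≤s x<t) = >⇒⟦≤⟧≡0 x<t

⟦≤⟧≤1 : ∀ t x → ⟦ t ≤ x ⟧ ≤ 1
⟦≤⟧≤1 zero    _       = ≤-refl
⟦≤⟧≤1 (suc t) zero    = z≤n
⟦≤⟧≤1 (suc t) (suc x) = ⟦≤⟧≤1 t x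

⟦≤⟧-antitone : ∀ t x → ⟦ suc t ≤ x ⟧ ≤ ⟦ t ≤ x ⟧
⟦≤⟧-antitone zero    x       = ⟦≤⟧≤1 1 x
⟦≤⟧-antitone (suc t) zero    = z≤n
⟦≤⟧-antitone (suc t) (suc x) = ⟦≤⟧-antitone t x

⟦≤⊔⁺⟧ : ∀ u a b → ⟦ 2 + u ≤ a ⊔⁺ b ⟧ ≤ ⟦ 2 + u ≤ a ⟧ + ⟦ 2 + u ≤ b ⟧ ⊎ (suc u ≤ a × suc u ≤ b)
⟦≤⊔⁺⟧ u a b with 2 + u ≤? a | 2 + u ≤? b
... | yes t≤a | _ rewrite ≤⇒⟦≤⟧≡1 t≤a = inj₁ (≤-trans (⟦≤⟧≤1 (2 + u) (a ⊔⁺ b)) (m≤m+n 1 _))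
... | no _ | yes t≤b rewrite ≤⇒⟦≤⟧≡1 t≤b = inj₁ (≤-trans (⟦≤⟧≤1 (2 + u) (a ⊔⁺ b)) (m≤n+m 1 _))
... | no a≱t | no b≱t with suc u ≤? a | suc u ≤? b
...   | yes u<a | yes u<b = inj₂ (u<a , u<b)
...   | no u≮a | _ = inj₁ (≤-trans (≤-reflexive (>⇒⟦≤⟧≡0 (s≤s c≤1+u))) z≤n)
  where c≤1+u = ⊔⁺-lub (≤-pred (≰⇒> a≱t)) (≤-pred (≰⇒> b≱t)) (inj₁ (≰⇒> u≮a))
...   | yes _ | no u≮b = inj₁ (≤-trans (≤-reflexive (>⇒⟦≤⟧≡0 (s≤s c≤1+u))) z≤n)
  where c≤1+u = ⊔⁺-lub (≤-pred (≰⇒> a≱t)) (≤-pred (≰⇒> b≱t)) (inj₂ (≰⇒> u≮b))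

⊔⁺-≤-∣∣ : ∀ {m a b} {p q r : Subset m} {x} → a ≤ ∣ p ∣ → b ≤ ∣ q ∣ → p ⊆ r → q ⊆ r → x ∈ₛ r →
          ¬ x ∈ₛ p ⊎ ¬ x ∈ₛ q → a ⊔⁺ b ≤ ∣ r ∣
⊔⁺-≤-∣∣ {x = x} a≤p b≤q p⊆r q⊆r x∈r (inj₁ x∉p) = ⊔⁺-lub (<⇒≤ a<r) (≤-trans b≤q (p⊆q⇒∣p∣≤∣q∣ q⊆r)) (inj₁ a<r)
  where a<r = ≤-<-trans a≤p (p⊂q⇒∣p∣<∣q∣ (p⊆r , x , x∈r , x∉p))
⊔⁺-≤-∣∣ {x = x} a≤p b≤q p⊆r q⊆r x∈r (inj₂ x∉q) = ⊔⁺-lub (≤-trans a≤p (p⊆q⇒∣p∣≤∣q∣ p⊆r)) (<⇒≤ b<r) (inj₂ b<r)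
  where b<r = ≤-<-trans b≤q (p⊂q⇒∣p∣<∣q∣ (q⊆r , x , x∈r , x∉q))

-- Bounded inflationary iterations

∑ : ∀ {m} → (Fin m → ℕ) → ℕ
∑ {zero}  f = 0
∑ {suc m} f = f zero + ∑ (f ∘ suc)

∑-mono-≤ : ∀ {m} {f g : Fin m → ℕ} → (∀ x → f x ≤ g x) → ∑ f ≤ ∑ g
∑-mono-≤ {zero}  f≤g = z≤n
∑-mono-≤ {suc m} f≤g = +-mono-≤ (f≤g zero) (∑-mono-≤ (f≤g ∘ suc))

∑-mono-< : ∀ {m} {f g : Fin m → ℕ} → (∀ x → f x ≤ g x) → ∀ x → f x < g x → ∑ f < ∑ g
∑-mono-< f≤g zero    fx<gx = +-mono-<-≤ fx<gx (∑-mono-≤ (f≤g ∘ suc))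
∑-mono-< f≤g (suc x) fx<gx = +-mono-≤-< (f≤g zero) (∑-mono-< (f≤g ∘ suc) x fx<gx)

∑≤m*c : ∀ {m} {f : Fin m → ℕ} c → (∀ x → f x ≤ c) → ∑ f ≤ m * c
∑≤m*c {zero}  c f≤c = z≤n
∑≤m*c {suc m} c f≤c = +-mono-≤ (f≤c zero) (∑≤m*c c (f≤c ∘ suc))

-- Until μ is stable, every iteration of F increases ∑ μ, which is bounded by m * c.
stabilises : ∀ {S : Set} {m} (F : S → S) (μ : S → Fin m → ℕ) c →
             (∀ s x → μ s x ≤ μ (F s) x) → (∀ s x → μ s x ≤ c) → S → ∃ λ s → ∀ x → μ (F s) x ≡ μ s x
stabilises {S} {m} F μ c inflationary bounded s₀ = search (suc (m * c)) s₀ (s≤s (m≤m+n (m * c) _))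
  where
  search : ∀ k s → m * c < k + ∑ (μ s) → ∃ λ s → ∀ x → μ (F s) x ≡ μ s x
  search zero    s overflow = contradiction (∑≤m*c c (bounded s)) (<⇒≱ overflow)
  search (suc k) s overflow with all? (λ x → μ (F s) x ≟ μ s x)
  ... | yes stable = s , stable
  ... | no unstable with ¬∀⟶∃¬ m _ (λ x → μ (F s) x ≟ μ s x) unstable
  ...   | x , changed = search k (F s) (<-≤-trans overflow (begin
    suc k + ∑ (μ s)   ≡⟨ +-suc k _ ⟨
    k + suc (∑ (μ s)) ≤⟨ +-monoʳ-≤ k (∑-mono-< (inflationary s) x (≤∧≢⇒< (inflationary s x) (changed ∘ sym))) ⟩
    k + ∑ (μ (F s))   ∎))
    where open ≤-Reasoning

module _ {d n : ℕ} (G : GVAS d n) where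

  -- Strahler numbers and derivation sequences

  strahler : ∀ {X} → Tree G X → ℕ
  strahler (node _ tA tB) = strahler tA ⊔⁺ strahler tB
  strahler (leaf _ _)     = 1

  0<strahler : ∀ {X} (T : Tree G X) → 0 < strahler T
  0<strahler (node _ tA tB) = <-≤-trans (0<strahler tA) (m≤m⊔⁺n _ _)
  0<strahler (leaf _ _)     = z<s

  nonterms-++ : ∀ s s′ → nonterms G (s ++ s′) ≡ nonterms G s + nonterms G s′
  nonterms-++ []           s′ = refl
  nonterms-++ (tm _ ∷ s)   s′ = nonterms-++ s s′
  nonterms-++ (pend _ ∷ s) s′ = cong suc (nonterms-++ s s′)

  terminal⇒nonterms≡0 : ∀ {s} → All (IsTm G) s → nonterms G s ≡ 0
  terminal⇒nonterms≡0 {[]}         []            = refl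
  terminal⇒nonterms≡0 {tm _ ∷ s}   (_ ∷ terminal) = terminal⇒nonterms≡0 terminal
  terminal⇒nonterms≡0 {pend _ ∷ s} (() ∷ _)

  countAtLeast : ℕ → List (Item G) → ℕ
  countAtLeast t []           = 0
  countAtLeast t (tm _ ∷ s)   = countAtLeast t s
  countAtLeast t (pend T ∷ s) = ⟦ t ≤ strahler T ⟧ + countAtLeast t s

  countAtLeast-++ : ∀ t s s′ → countAtLeast t (s ++ s′) ≡ countAtLeast t s + countAtLeast t s′
  countAtLeast-++ t []           s′ = refl
  countAtLeast-++ t (tm _ ∷ s)   s′ = countAtLeast-++ t s s′
  countAtLeast-++ t (pend T ∷ s) s′ =
    trans (cong (⟦ t ≤ strahler T ⟧ +_) (countAtLeast-++ t s s′))
          (sym (+-assoc ⟦ t ≤ strahler T ⟧ (countAtLeast t s) (countAtLeast t s′)))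

  countAtLeast≤nonterms : ∀ t s → countAtLeast t s ≤ nonterms G s
  countAtLeast≤nonterms t []           = z≤n
  countAtLeast≤nonterms t (tm _ ∷ s)   = countAtLeast≤nonterms t s
  countAtLeast≤nonterms t (pend T ∷ s) = +-mono-≤ (⟦≤⟧≤1 t (strahler T)) (countAtLeast≤nonterms t s)

  countAtLeast-antitone : ∀ t s → countAtLeast (suc t) s ≤ countAtLeast t s
  countAtLeast-antitone t []           = z≤n
  countAtLeast-antitone t (tm _ ∷ s)   = countAtLeast-antitone t s
  countAtLeast-antitone t (pend T ∷ s) = +-mono-≤ (⟦≤⟧-antitone t (strahler T)) (countAtLeast-antitone t s)

  terminal⇒countAtLeast≡0 : ∀ t {s} → All (IsTm G) s → countAtLeast t s ≡ 0
  terminal⇒countAtLeast≡0 t {s} terminal =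
    ≤-antisym (≤-trans (countAtLeast≤nonterms t s) (≤-reflexive (terminal⇒nonterms≡0 terminal))) z≤n

  -- A step lowers the count at threshold 2 + u only by splitting a node into two children whose
  -- Strahler numbers are both at least 1 + u.
  step-potential : ∀ {s s′} → Step G s s′ → ∀ u →
                   countAtLeast (2 + u) s ≤ countAtLeast (2 + u) s′ ⊎
                   suc (countAtLeast (2 + u) s) ≤ countAtLeast (suc u) s′
  step-potential (expand pre post r tA tB) u
    rewrite countAtLeast-++ (2 + u) pre (pend (node r tA tB) ∷ post)
          | countAtLeast-++ (2 + u) pre (pend tA ∷ pend tB ∷ post)
          | countAtLeast-++ (suc u) pre (pend tA ∷ pend tB ∷ post)
    with ⟦≤⊔⁺⟧ u (strahler tA) (strahler tB)
  ... | inj₁ c≤a+b = inj₁ (+-monoʳ-≤ (countAtLeast (2 + u) pre)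
    (≤-trans (+-monoˡ-≤ (countAtLeast (2 + u) post) c≤a+b)
             (≤-reflexive (+-assoc ⟦ 2 + u ≤ strahler tA ⟧ ⟦ 2 + u ≤ strahler tB ⟧ _))))
  ... | inj₂ (u<a , u<b) rewrite ≤⇒⟦≤⟧≡1 u<a | ≤⇒⟦≤⟧≡1 u<b =
    inj₂ (≤-trans (s≤s (+-mono-≤ (countAtLeast-antitone (suc u) pre)
                                 (+-mono-≤ (⟦≤⟧≤1 (2 + u) (strahler tA ⊔⁺ strahler tB)) (countAtLeast-antitone (suc u) post))))
                  (≤-reflexive (sym (+-suc _ _))))
  step-potential (finish pre post v r) u
    rewrite countAtLeast-++ (2 + u) pre (pend (leaf v r) ∷ post)
          | countAtLeast-++ (2 + u) pre (tm v ∷ post) = inj₁ ≤-refl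

  run-bound : ∀ {s m} → Run G s m → ∀ u → 0 < countAtLeast (suc u) s → u + countAtLeast (suc u) s ≤ m
  run-bound (stop s terminal) u pos =
    contradiction (subst (0 <_) (terminal⇒countAtLeast≡0 (suc u) terminal) pos) λ ()
  run-bound (go {s = s} st run) zero _ = ≤-trans (countAtLeast≤nonterms 1 s) (m≤m⊔n _ _)
  run-bound (go {s = s} {s′} {m} st run) (suc u) pos with step-potential st u
  ... | inj₁ s≤s′ =
    ≤-trans (+-monoʳ-≤ (suc u) s≤s′) (≤-trans (run-bound run (suc u) (<-≤-trans pos s≤s′)) (m≤n⊔m _ _))
  ... | inj₂ s<s′ = begin
    suc u + countAtLeast (2 + u) s    ≡⟨ +-suc u _ ⟨
    u + suc (countAtLeast (2 + u) s)  ≤⟨ +-monoʳ-≤ u s<s′ ⟩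
    u + countAtLeast (suc u) s′       ≤⟨ run-bound run u (<-≤-trans z<s s<s′) ⟩
    m                                 ≤⟨ m≤n⊔m _ _ ⟩
    nonterms G s ⊔ m                  ∎
    where open ≤-Reasoning

  strahler≤run : ∀ {X} {T : Tree G X} {m} → Run G (pend T ∷ []) m → strahler T ≤ m
  strahler≤run {T = T} {m} run = ≮⇒≥ λ m<T → n≮n m (below m m<T)
    where
    below : ∀ u → u < strahler T → u < m
    below u u<T with ⟦ suc u ≤ strahler T ⟧ | ≤⇒⟦≤⟧≡1 u<T | run-bound run u
    ... | _ | refl | bound = m+1≤n⇒m<n (bound z<s)

  BoundedStep : ℕ → List (Item G) → List (Item G) → Set
  BoundedStep b s s′ = Step G s s′ × nonterms G s ≤ b

  Steps : ℕ → List (Item G) → List (Item G) → Set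
  Steps b = Star (BoundedStep b)

  Step-++ʳ : ∀ {s s′} post → Step G s s′ → Step G (s ++ post) (s′ ++ post)
  Step-++ʳ post (expand pre post′ r tA tB) =
    subst₂ (Step G) (sym (++-assoc pre _ post)) (sym (++-assoc pre _ post)) (expand pre (post′ ++ post) r tA tB)
  Step-++ʳ post (finish pre post′ u r) =
    subst₂ (Step G) (sym (++-assoc pre _ post)) (sym (++-assoc pre _ post)) (finish pre (post′ ++ post) u r)

  Step-++ˡ : ∀ {s s′} pre → Step G s s′ → Step G (pre ++ s) (pre ++ s′)
  Step-++ˡ pre (expand pre′ post r tA tB) =
    subst₂ (Step G) (++-assoc pre pre′ _) (++-assoc pre pre′ _) (expand (pre ++ pre′) post r tA tB)
  Step-++ˡ pre (finish pre′ post u r) =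
    subst₂ (Step G) (++-assoc pre pre′ _) (++-assoc pre pre′ _) (finish (pre ++ pre′) post u r)

  Steps-++ʳ : ∀ {b s s′} post → Steps b s s′ → Steps (b + nonterms G post) (s ++ post) (s′ ++ post)
  Steps-++ʳ post = gmap (_++ post) λ {s} (st , s≤b) →
    Step-++ʳ post st , ≤-trans (≤-reflexive (nonterms-++ s post)) (+-monoˡ-≤ (nonterms G post) s≤b)

  Steps-++ˡ : ∀ {b s s′} pre → Steps b s s′ → Steps (nonterms G pre + b) (pre ++ s) (pre ++ s′)
  Steps-++ˡ pre = gmap (pre ++_) λ {s} (st , s≤b) →
    Step-++ˡ pre st , ≤-trans (≤-reflexive (nonterms-++ pre s)) (+-monoʳ-≤ (nonterms G pre) s≤b)

  Steps-weaken : ∀ {b b′ s s′} → b ≤ b′ → Steps b s s′ → Steps b′ s s′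
  Steps-weaken b≤b′ = Star.map λ (st , s≤b) → st , ≤-trans s≤b b≤b′

  Steps⇒Run : ∀ {b s w} → Steps b s w → All (IsTm G) w → ∃ λ m → Run G s m × m ≤ b
  Steps⇒Run {w = w} ε terminal =
    nonterms G w , stop w terminal , ≤-trans (≤-reflexive (terminal⇒nonterms≡0 terminal)) z≤n
  Steps⇒Run ((st , s≤b) ◅ steps) terminal with Steps⇒Run steps terminal
  ... | m , run , m≤b = _ , go st run , ⊔-lub s≤b m≤b

  Schedule : ∀ {X} → Tree G X → Set
  Schedule T = ∃ λ w → All (IsTm G) w × Steps (strahler T) (pend T ∷ []) w

  -- Expanding the subtree of larger Strahler number first keeps the other one waiting as a single
  -- extra nonterminal occurrence; this is where the 1 + min in the definition of ⊔⁺ comes from.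
  schedule-node : ∀ {X A B} (r : bin X A B ∈ rules G) {tA : Tree G A} {tB : Tree G B} →
                  Schedule tA → Schedule tB → Schedule (node r tA tB)
  schedule-node r {tA} {tB} (wA , wA-terminal , stepsA) (wB , wB-terminal , stepsB) =
    wA ++ wB , All.++⁺ wA-terminal wB-terminal , (expand [] [] r tA tB , 0<strahler (node r tA tB)) ◅ children
    where
    a = strahler tA
    b = strahler tB
    children : Steps (a ⊔⁺ b) (pend tA ∷ pend tB ∷ []) (wA ++ wB)
    children with a ≤? b
    ... | yes a≤b =
      Steps-weaken (m<n⇒m+1≤n (m≤n⇒m<m⊔⁺n a≤b)) (Steps-++ʳ (pend tB ∷ []) stepsA) ◅◅
      Steps-weaken (≤-trans (≤-reflexive (cong (_+ b) (terminal⇒nonterms≡0 wA-terminal))) (n≤m⊔⁺n a b))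
                   (Steps-++ˡ wA stepsB)
    ... | no a≰b =
      Steps-weaken (n≤m⇒n<m⊔⁺n (<⇒≤ (≰⇒> a≰b))) (Steps-++ˡ (pend tA ∷ []) stepsB) ◅◅
      Steps-weaken (≤-trans (≤-reflexive (trans (cong (a +_) (terminal⇒nonterms≡0 wB-terminal)) (+-identityʳ a)))
                            (m≤m⊔⁺n a b))
                   (Steps-++ʳ wB stepsA)

  schedule : ∀ {X} (T : Tree G X) → Schedule T
  schedule (node r tA tB) = schedule-node r (schedule tA) (schedule tB)
  schedule (leaf u r)     = tm u ∷ [] , _ ∷ [] , (finish [] [] u r , ≤-refl) ◅ ε

  strahler-isKT : ∀ {X} (T : Tree G X) → IsKT G T (strahler T)
  strahler-isKT T with schedule T
  ... | w , terminal , steps with Steps⇒Run steps terminal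
  ...   | m , run , m≤T = subst (Run G (pend T ∷ [])) (≤-antisym m≤T (strahler≤run run)) run
                        , λ _ → strahler≤run

  IsKT⇒≡strahler : ∀ {X k} {T : Tree G X} → IsKT G T k → k ≡ strahler T
  IsKT⇒≡strahler {T = T} (run , least) = ≤-antisym (least _ (proj₁ (strahler-isKT T))) (proj₂ (strahler-isKT T) _ run)

  -- Trees of maximal Strahler number

  SameSCC-refl : ∀ {X} → SameSCC G X X
  SameSCC-refl = ε , ε

  SameSCC-trans : ∀ {X Y Z} → SameSCC G X Y → SameSCC G Y Z → SameSCC G X Z
  SameSCC-trans (X→Y , Y→X) (Y→Z , Z→Y) = X→Y ◅◅ Y→Z , Z→Y ◅◅ Y→X

  edgeˡ : ∀ {X A B} → bin X A B ∈ rules G → Reach G X A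
  edgeˡ {A = A} {B} r = (A , B , r , inj₁ refl) ◅ ε

  edgeʳ : ∀ {X A B} → bin X A B ∈ rules G → Reach G X B
  edgeʳ {A = A} {B} r = (A , B , r , inj₂ refl) ◅ ε

  symbols : ∀ {X} → Tree G X → Subset n
  symbols {X} (node _ tA tB) = ⁅ X ⁆ ∪ (symbols tA ∪ symbols tB)
  symbols {X} (leaf _ _)     = ⁅ X ⁆

  ∈symbols⇒Reach : ∀ {X Y} (T : Tree G X) → Y ∈ₛ symbols T → Reach G X Y
  ∈symbols⇒Reach {X} (leaf _ _) Y∈T rewrite x∈⁅y⁆⇒x≡y X Y∈T = ε
  ∈symbols⇒Reach {X} (node r tA tB) Y∈T with x∈p∪q⁻ ⁅ X ⁆ _ Y∈T
  ... | inj₁ Y∈X rewrite x∈⁅y⁆⇒x≡y X Y∈X = ε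
  ... | inj₂ Y∈AB with x∈p∪q⁻ (symbols tA) _ Y∈AB
  ...   | inj₁ Y∈A = edgeˡ r ◅◅ ∈symbols⇒Reach tA Y∈A
  ...   | inj₂ Y∈B = edgeʳ r ◅◅ ∈symbols⇒Reach tB Y∈B

  -- In a thin grammar the root symbol cannot occur below both children of a node, so one child
  -- has strictly fewer symbols; this bounds the Strahler number by the number of symbols.
  strahler≤∣symbols∣ : Thin G → ∀ {X} (T : Tree G X) → strahler T ≤ ∣ symbols T ∣
  strahler≤∣symbols∣ thin {X} (leaf _ _) = ≤-reflexive (sym (∣⁅x⁆∣≡1 X))
  strahler≤∣symbols∣ thin {X} (node {A = A} {B} r tA tB) =
    ⊔⁺-≤-∣∣ (strahler≤∣symbols∣ thin tA) (strahler≤∣symbols∣ thin tB)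
            (q⊆p∪q ⁅ X ⁆ _ ∘ p⊆p∪q (symbols tB)) (q⊆p∪q ⁅ X ⁆ _ ∘ q⊆p∪q (symbols tA) _)
            (p⊆p∪q _ (x∈⁅x⁆ X)) X∉A⊎X∉B
    where
    X∉A⊎X∉B : ¬ X ∈ₛ symbols tA ⊎ ¬ X ∈ₛ symbols tB
    X∉A⊎X∉B with X ∈ₛ? symbols tA | X ∈ₛ? symbols tB
    ... | yes X∈A | yes X∈B =
      contradiction ((edgeˡ r , ∈symbols⇒Reach tA X∈A) , (edgeʳ r , ∈symbols⇒Reach tB X∈B)) (thin X A B r)
    ... | no X∉A | _        = inj₁ X∉A
    ... | yes _  | no X∉B   = inj₂ X∉B

  strahler≤n : Thin G → ∀ {X} (T : Tree G X) → strahler T ≤ n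
  strahler≤n thin T = ≤-trans (strahler≤∣symbols∣ thin T) (∣p∣≤n (symbols T))

  candidate : (∀ Y → Tree G Y) → ∀ X {r} → r ∈ rules G → Tree G X
  candidate best X {bin Y A B} r with Y Fin.≟ X
  ... | yes refl = node r (best A) (best B)
  ... | no _     = best X
  candidate best X {term _ _} _ = best X

  candidate-bin : ∀ best {X A B} (r : bin X A B ∈ rules G) → candidate best X r ≡ node r (best A) (best B)
  candidate-bin best {X} r with X Fin.≟ X
  ... | yes refl = refl
  ... | no X≢X   = contradiction refl X≢X

  improve : (∀ Y → Tree G Y) → ∀ X → Tree G X
  improve best X = argmax strahler (best X) (mapWith∈ (rules G) (candidate best X))

  improve-inflationary : ∀ best X → strahler (best X) ≤ strahler (improve best X)
  improve-inflationary best X = f[⊥]≤f[argmax] {f = strahler} (best X) (mapWith∈ (rules G) (candidate best X))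

  node≤improve : ∀ best {X A B} (r : bin X A B ∈ rules G) →
                 strahler (best A) ⊔⁺ strahler (best B) ≤ strahler (improve best X)
  node≤improve best {X} r = subst (λ T → strahler T ≤ strahler (improve best X)) (candidate-bin best r)
    (All.lookup (f[xs]≤f[argmax] {f = strahler} (best X) _) (mapWith∈⁺ (candidate best X) (_ , r , refl)))

  maximal-trees : Proper G → Thin G →
                  ∃ λ (best : ∀ X → Tree G X) → ∀ {X} (T : Tree G X) → strahler T ≤ strahler (best X)
  maximal-trees proper thin with
    stabilises improve (λ best X → strahler (best X)) n improve-inflationary (λ best → strahler≤n thin ∘ best)
               (proj₂ proper)
  ... | best , stable = best , maximal
    where
    maximal : ∀ {X} (T : Tree G X) → strahler T ≤ strahler (best X)
    maximal {X} (node r tA tB) =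
      ≤-trans (⊔⁺-mono-≤ (maximal tA) (maximal tB)) (≤-trans (node≤improve best r) (≤-reflexive (stable X)))
    maximal {X} (leaf _ _) = 0<strahler (best X)

  -- The recursive index

  _⊏_ : Fin n → Fin n → Set
  A ⊏ X = Reach G X A × ¬ Reach G A X

  ⊏-wellFounded : WellFounded _⊏_
  ⊏-wellFounded = spo-wellFounded {_≈_ = _≡_} record
    { isEquivalence = isEquivalence
    ; irrefl        = λ { refl (X→X , ¬X→X) → ¬X→X X→X }
    ; trans         = λ (Y→X , ¬X→Y) (Z→Y , ¬Y→Z) → Z→Y ◅◅ Y→X , λ X→Z → ¬X→Y (X→Z ◅◅ Z→Y)
    ; <-resp-≈      = (λ { refl A⊏X → A⊏X }) , (λ { refl A⊏X → A⊏X })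
    }

  ⊏-child : ∀ {X Y A} → SameSCC G X Y → Reach G Y A → ¬ SameSCC G Y A → A ⊏ X
  ⊏-child (X→Y , Y→X) Y→A ¬Y≈A = X→Y ◅◅ Y→A , λ A→X → ¬Y≈A (Y→A , A→X ◅◅ X→Y)

  -- IndexOK G ι X k unfolds to 1 ≤ k × (∀ Y A B → SameSCC G X Y → bin Y A B ∈ rules G → RuleBound ι k Y A B).
  RuleBound : (Fin n → ℕ) → ℕ → Fin n → Fin n → Fin n → Set
  RuleBound ι k Y A B =
    ((¬ SameSCC G Y A × SameSCC G Y B) → ι A + 1 ≤ k) ×
    ((SameSCC G Y A × ¬ SameSCC G Y B) → ι B + 1 ≤ k) ×
    ((¬ SameSCC G Y A × ¬ SameSCC G Y B) → (ι A ≢ ι B → ι A ⊔ ι B ≤ k) × (ι A ≡ ι B → ι A + 1 ≤ k))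

  RuleBound-antitone : ∀ {f g k Y A B} → (¬ SameSCC G Y A → f A ≤ g A) → (¬ SameSCC G Y B → f B ≤ g B) →
                       RuleBound g k Y A B → RuleBound f k Y A B
  RuleBound-antitone fA≤gA fB≤gB (left , right , full) =
      (λ deg@(¬Y≈A , _) → ≤-trans (+-monoˡ-≤ 1 (fA≤gA ¬Y≈A)) (left deg))
    , (λ deg@(_ , ¬Y≈B) → ≤-trans (+-monoˡ-≤ 1 (fB≤gB ¬Y≈B)) (right deg))
    , (λ deg@(¬Y≈A , ¬Y≈B) → ⊔⁺-≤-cases (≤-trans (⊔⁺-mono-≤ (fA≤gA ¬Y≈A) (fB≤gB ¬Y≈B))
                                                 (⊔⁺-lub-cases (full deg))))

  IndexOK-antitone : ∀ {f g X k} → (∀ A → A ⊏ X → f A ≤ g A) → IndexOK G g X k → IndexOK G f X k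
  IndexOK-antitone f≤g (1≤k , bounds) = 1≤k , λ Y A B X≈Y r →
    RuleBound-antitone (f≤g A ∘ ⊏-child X≈Y (edgeˡ r)) (f≤g B ∘ ⊏-child X≈Y (edgeʳ r)) (bounds Y A B X≈Y r)

  -- IndexOK ι X only involves ι strictly below X, so ι is determined by well-founded recursion.
  index-unique : ∀ {ι ι′} → IsIndexFn G ι → IsIndexFn G ι′ → ∀ X → ι X ≡ ι′ X
  index-unique {ι} {ι′} ι-index ι′-index X = unique X (⊏-wellFounded X)
    where
    unique : ∀ X → Acc _⊏_ X → ι X ≡ ι′ X
    unique X (acc below) = ≤-antisym
      (proj₂ (ι-index X) (ι′ X) (IndexOK-antitone (λ _ → ≤-reflexive ∘ ι≡ι′) (proj₁ (ι′-index X))))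
      (proj₂ (ι′-index X) (ι X) (IndexOK-antitone (λ _ → ≤-reflexive ∘ sym ∘ ι≡ι′) (proj₁ (ι-index X))))
      where
      ι≡ι′ : ∀ {A} → A ⊏ X → ι A ≡ ι′ A
      ι≡ι′ A⊏X = unique _ (below A⊏X)

  -- The case analysis on SCC membership is classical, which is harmless since the goal is decidable.
  RuleBound⇒⊔⁺≤ : Thin G → ∀ {f k Y A B} → bin Y A B ∈ rules G → RuleBound f k Y A B → ∀ {a b} →
                  (SameSCC G Y A → a ≤ k) → (¬ SameSCC G Y A → a ≤ f A) →
                  (SameSCC G Y B → b ≤ k) → (¬ SameSCC G Y B → b ≤ f B) → a ⊔⁺ b ≤ k
  RuleBound⇒⊔⁺≤ thin {f} {k} {Y} {A} {B} r (left , right , full) {a} {b} inA outA inB outB =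
    decidable-stable (a ⊔⁺ b ≤? k) λ ¬goal →
      ¬¬-excluded-middle λ Y≈A? → ¬¬-excluded-middle λ Y≈B? → ¬goal (cases Y≈A? Y≈B?)
    where
    cases : Dec (SameSCC G Y A) → Dec (SameSCC G Y B) → a ⊔⁺ b ≤ k
    cases (yes Y≈A) (yes Y≈B) = contradiction (Y≈A , Y≈B) (thin Y A B r)
    cases (yes Y≈A) (no ¬Y≈B) = ⊔⁺-lub (inA Y≈A) (<⇒≤ b<k) (inj₂ b<k)
      where b<k = ≤-<-trans (outB ¬Y≈B) (m+1≤n⇒m<n (right (Y≈A , ¬Y≈B)))
    cases (no ¬Y≈A) (yes Y≈B) = ⊔⁺-lub (<⇒≤ a<k) (inB Y≈B) (inj₁ a<k)
      where a<k = ≤-<-trans (outA ¬Y≈A) (m+1≤n⇒m<n (left (¬Y≈A , Y≈B)))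
    cases (no ¬Y≈A) (no ¬Y≈B) = ≤-trans (⊔⁺-mono-≤ (outA ¬Y≈A) (outB ¬Y≈B))
                                        (⊔⁺-lub-cases (full (¬Y≈A , ¬Y≈B)))

module MaxStrahler {d n} {G : GVAS d n} (proper : Proper G) (thin : Thin G) where

  best : ∀ X → Tree G X
  best = proj₁ (maximal-trees G proper thin)

  maxStrahler : Fin n → ℕ
  maxStrahler X = strahler G (best X)

  strahler≤maxStrahler : ∀ {X} (T : Tree G X) → strahler G T ≤ maxStrahler X
  strahler≤maxStrahler = proj₂ (maximal-trees G proper thin)

  maxStrahler-node : ∀ {X A B} → bin X A B ∈ rules G → maxStrahler A ⊔⁺ maxStrahler B ≤ maxStrahler X
  maxStrahler-node r = strahler≤maxStrahler (node r (best _) (best _))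

  maxStrahler-antitone : ∀ {X Y} → Reach G X Y → maxStrahler Y ≤ maxStrahler X
  maxStrahler-antitone ε = ≤-refl
  maxStrahler-antitone ((_ , _ , r , inj₁ refl) ◅ path) =
    ≤-trans (maxStrahler-antitone path) (≤-trans (m≤m⊔⁺n _ _) (maxStrahler-node r))
  maxStrahler-antitone ((_ , _ , r , inj₂ refl) ◅ path) =
    ≤-trans (maxStrahler-antitone path) (≤-trans (n≤m⊔⁺n _ _) (maxStrahler-node r))

  maxStrahler-SCC : ∀ {X Y} → SameSCC G X Y → maxStrahler X ≡ maxStrahler Y
  maxStrahler-SCC (X→Y , Y→X) = ≤-antisym (maxStrahler-antitone Y→X) (maxStrahler-antitone X→Y)

  maxStrahler-RuleBound : ∀ {Y A B} → bin Y A B ∈ rules G → RuleBound G maxStrahler (maxStrahler Y) Y A B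
  maxStrahler-RuleBound {Y} {A} {B} r =
      (λ (_ , Y≈B) → m<n⇒m+1≤n (m⊔⁺n≤n⇒m<n
        (subst (λ k → maxStrahler A ⊔⁺ k ≤ maxStrahler Y) (sym (maxStrahler-SCC Y≈B)) (maxStrahler-node r))))
    , (λ (Y≈A , _) → m<n⇒m+1≤n (m⊔⁺n≤m⇒n<m
        (subst (λ k → k ⊔⁺ maxStrahler B ≤ maxStrahler Y) (sym (maxStrahler-SCC Y≈A)) (maxStrahler-node r))))
    , (λ _ → ⊔⁺-≤-cases (maxStrahler-node r))

  maxStrahler-minimal : ∀ {X Y k} → IndexOK G maxStrahler X k → SameSCC G X Y → (T : Tree G Y) → strahler G T ≤ k
  maxStrahler-minimal (1≤k , _) _ (leaf _ _) = 1≤k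
  maxStrahler-minimal ok@(_ , bounds) X≈Y (node r tA tB) = RuleBound⇒⊔⁺≤ G thin r (bounds _ _ _ X≈Y r)
    (λ Y≈A → maxStrahler-minimal ok (SameSCC-trans G X≈Y Y≈A) tA) (λ _ → strahler≤maxStrahler tA)
    (λ Y≈B → maxStrahler-minimal ok (SameSCC-trans G X≈Y Y≈B) tB) (λ _ → strahler≤maxStrahler tB)

  maxStrahler-isIndexFn : IsIndexFn G maxStrahler
  maxStrahler-isIndexFn X =
    ( 0<strahler G (best X)
    , λ Y A B X≈Y r → subst (λ k → RuleBound G maxStrahler k Y A B) (sym (maxStrahler-SCC X≈Y)) (maxStrahler-RuleBound r))
    , λ k ok → maxStrahler-minimal ok (SameSCC-refl G) (best X)

lemmaA2 : ∀ {d n} (G : GVAS d n) → Proper G → Thin G →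
          Σ (Fin n → ℕ) (IsIndexFn G) ×
          (∀ ι → IsIndexFn G ι →
            IsLUB (λ k → Σ (Tree G (start G)) (λ T → IsKT G T k)) (ι (start G)))
lemmaA2 G proper thin = (maxStrahler , maxStrahler-isIndexFn) , λ ι ι-index →
  let M≡ι = index-unique G maxStrahler-isIndexFn ι-index (start G) in
    (λ k (T , T-k) → subst (k ≤_) M≡ι (≤-trans (≤-reflexive (IsKT⇒≡strahler G T-k)) (strahler≤maxStrahler T)))
  , (λ b bounds → subst (_≤ b) M≡ι (bounds _ (best (start G) , strahler-isKT G (best (start G)))))
  where open MaxStrahler proper thin
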